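{- Let $k\ge1$ be an integer and $\alpha\in\mathbb{Z}^+$ with $3\mid\alpha$ and $9\nmid\alpha$. Then \[|\mathcal{T}(\alpha,[2^k3^2])|\ge|\mathcal{T}(\alpha,[2^{k-1}3^2])|+|\mathcal{T}(\alpha/2,[2^{k-1}3^2])|+|\mathcal{T}(\alpha/3,[2^k])|.\]
   Context: $[n]=\{1,\dots,n\}$. $A+B$ is the Minkowski sum. For finite $C\subset\mathbb{Z}$ and $\alpha\in\mathbb{Z}^+$, $\mathcal{T}(\alpha,C)$ is the set of pairs $(A,B)$ of finite subsets of $\mathbb{Z}$ with $A+B=C$, $|C|=|A||B|$, $|A|=\alpha$, $0\in B$ and $\min B\ge0$. If $\alpha$ is not a positive integer, $\mathcal{T}(\alpha,C)=\emptyset$. -}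

module Defs where

open import Data.Nat using (ℕ; suc) renaming (_*_ to _*ℕ_)
open import Data.Integer using (ℤ; +_; _+_; _<_; _≤_)
open import Data.List using (List; length; map; upTo)
open import Data.List.Membership.Propositional using (_∈_)
open import Data.List.Relation.Unary.All using (All)
open import Data.List.Relation.Unary.Linked using (Linked)
open import Data.Product using (∃; ∃-syntax; _×_)
open import Data.Fin using (Fin)
open import Function.Bundles using (_⇔_; _↔_)
open import Relation.Binary.PropositionalEquality using (_≡_)

-- A finite subset of ℤ is represented canonically by a strictly increasing list.
-- [n] = {1,…,n} as a strictly increasing list.
interval : ℕ → List ℤ
interval n = map (λ i → + suc i) (upTo n)

-- Elements of 𝒯(α / d, C): pairs (A , B) of finite subsets of ℤ (strictly sorted lists)
-- with A + B = C, |C| = |A||B|, |A| = α / d (i.e. |A| * d = α), 0 ∈ B, min B ≥ 0.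
-- If α / d is not a positive integer (and α ≥ 1), there is no such A, so the set is empty.
-- Proof fields are irrelevant so that an element is determined by the pair (A , B).
record 𝒯 (α d : ℕ) (C : List ℤ) : Set where
  constructor mk𝒯
  field
    A B      : List ℤ
    .A-set   : Linked _<_ A
    .B-set   : Linked _<_ B
    .sumset  : ∀ c → (c ∈ C) ⇔ (∃[ a ] ∃[ b ] (a ∈ A × b ∈ B × c ≡ a + b))
    .card    : length C ≡ length A *ℕ length B
    .sizeA   : length A *ℕ d ≡ α
    .zero∈B  : (+ 0) ∈ B
    .minB    : All (λ b → + 0 ≤ b) B

HasCard : Set → ℕ → Set
HasCard X m = X ↔ Fin m

module Submission where

-- Write u = 2^(k-1), so the three intervals are [18u], [9u] and [2u]. Each of the
-- three families on the right embeds into 𝒯(α, [18u]):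
--   (A, B) ↦ (A, B ∪ (B + 9u))                                  from 𝒯(α, [9u]),
--   (A, B) ↦ (A ∪ (A + 9u), B)                                  from 𝒯(α/2, [9u]),
--   (A, B) ↦ (A ∪ (A + 2u) ∪ (A + 4u), B ∪ (B + 6u) ∪ (B + 12u))  from 𝒯(α/3, [2u]).
-- The images are disjoint: only the first has 9u in its B (the second has B ⊆ [0, 9u), the
-- third has B ⊆ [0, 2u) ∪ [6u, 8u) ∪ [12u, 14u)), and only the second has an element beyond
-- 9u in its A (the third has A ⊆ [1, 6u]). This needs just α ≥ 1.

open import Defs
open import Data.Nat using (ℕ; zero; suc; z<s; s<s; s≤s; _+_; _*_; _^_; _≤_; _<_; _∸_; _≤?_; _<?_)
open import Data.Nat.Divisibility using (_∣_)
import Data.Nat.Properties as ℕ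
open import Algebra.Properties.CommutativeSemigroup ℕ.*-commutativeSemigroup using (x∙yz≈y∙xz; xy∙z≈y∙xz)
open import Data.Nat.Tactic.RingSolver using (solve-∀)
open import Data.Integer as ℤ using (ℤ; +_) renaming (_+_ to _+ℤ_; _<_ to _<ℤ_; _≤_ to _≤ℤ_)
import Data.Integer.Properties as ℤ
open import Data.List using (List; []; _∷_; _++_; map; length; upTo)
open import Data.List.Properties using (length-map; length-++; length-applyUpTo; ∷-injective)
open import Data.List.Membership.Propositional using (_∈_; _∉_)
open import Data.List.Membership.Propositional.Properties
  using (∈-map⁺; ∈-map⁻; ∈-++⁺ˡ; ∈-++⁺ʳ; ∈-++⁻; ∈-upTo⁺; ∈-upTo⁻)
open import Data.List.Relation.Unary.Any using (here)
open import Data.List.Relation.Unary.All as All using (All)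
open import Data.List.Relation.Unary.AllPairs as AllPairs using (AllPairs)
import Data.List.Relation.Unary.AllPairs.Properties as AllPairs
open import Data.List.Relation.Unary.Linked using (Linked)
open import Data.List.Relation.Unary.Linked.Properties using (AllPairs⇒Linked; Linked⇒AllPairs)
open import Data.Product using (∃-syntax; _×_; _,_; proj₂)
open import Data.Sum using (_⊎_; inj₁; inj₂; [_,_])
open import Data.Sum.Function.Propositional using (_⊎-↔_)
open import Data.Empty using (⊥; ⊥-elim; ⊥-elim-irr)
open import Data.Fin.Properties using (+↔⊎; injective⇒≤)
open import Function using (_∘_)
open import Function.Bundles using (_⇔_; mk⇔; Equivalence; _↣_; mk↣; Injection)
open import Function.Definitions using (Injective)
open import Function.Construct.Composition using (_⇔-∘_; _↔-∘_; _↣-∘_)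
open import Function.Construct.Symmetry using (⇔-sym; ↔-sym)
open import Function.Properties.Inverse using (↔⇒↣)
open import Relation.Nullary using (¬_; yes; no)
open import Relation.Binary.PropositionalEquality hiding ([_])

open Equivalence using (to; from)

InSumset : List ℤ → List ℤ → ℤ → Set
InSumset X Y c = ∃[ a ] ∃[ b ] (a ∈ X × b ∈ Y × c ≡ a +ℤ b)

IsSumset : List ℤ → List ℤ → List ℤ → Set
IsSumset C X Y = ∀ c → c ∈ C ⇔ InSumset X Y c

Tiles : ℕ → List ℤ → List ℤ → Set
Tiles n = IsSumset (interval n)

translates : ℕ → ℕ → List ℤ → List ℤ
translates zero    t X = []
translates (suc m) t X = X ++ map (_+ℤ + t) (translates m t X)

Window : ℕ → ℕ → ℤ → Set
Window o n x = ∃[ j ] (j < n × x ≡ + (o + j))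

WidthBelow : ℕ → List ℤ → Set
WidthBelow t X = ∀ {x y} → x ∈ X → y ∈ X → x <ℤ y +ℤ + t

∈-interval : ∀ {n c} → c ∈ interval n ⇔ Window 1 n c
∈-interval = mk⇔ fwd bwd
  where
  fwd : ∀ {n c} → c ∈ interval n → Window 1 n c
  fwd c∈ with i , i∈ , refl ← ∈-map⁻ _ c∈ = i , ∈-upTo⁻ i∈ , refl
  bwd : ∀ {n c} → Window 1 n c → c ∈ interval n
  bwd (i , i<n , refl) = ∈-map⁺ _ (∈-upTo⁺ i<n)

length-interval : ∀ n → length (interval n) ≡ n
length-interval n = trans (length-map _ (upTo n)) (length-applyUpTo _ n)

∈-++-shift : ∀ {C D t c} → c ∈ C ++ map (_+ℤ t) D ⇔ (c ∈ C ⊎ ∃[ d ] (d ∈ D × c ≡ d +ℤ t))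
∈-++-shift {C} {D} {t} = mk⇔ fwd bwd
  where
  fwd : ∀ {c} → c ∈ C ++ map (_+ℤ t) D → c ∈ C ⊎ ∃[ d ] (d ∈ D × c ≡ d +ℤ t)
  fwd c∈ with ∈-++⁻ C c∈
  ... | inj₁ c∈C   = inj₁ c∈C
  ... | inj₂ c∈D+t = inj₂ (∈-map⁻ (_+ℤ t) c∈D+t)
  bwd : ∀ {c} → c ∈ C ⊎ ∃[ d ] (d ∈ D × c ≡ d +ℤ t) → c ∈ C ++ map (_+ℤ t) D
  bwd (inj₁ c∈C)             = ∈-++⁺ˡ c∈C
  bwd (inj₂ (d , d∈D , refl)) = ∈-++⁺ʳ C (∈-map⁺ (_+ℤ t) d∈D)

∈-interval-+ : ∀ n p {c} → c ∈ interval (n + p) ⇔ c ∈ interval n ++ map (_+ℤ + n) (interval p)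
∈-interval-+ n p = ⇔-sym ∈-++-shift ⇔-∘ (mk⇔ fwd bwd ⇔-∘ ∈-interval)
  where
  fwd : ∀ {c} → Window 1 (n + p) c → c ∈ interval n ⊎ ∃[ d ] (d ∈ interval p × c ≡ d +ℤ + n)
  fwd (i , i<n+p , refl) with i <? n
  ... | yes i<n = inj₁ (from ∈-interval (i , i<n , refl))
  ... | no  i≮n with j , refl ← ℕ.m≤n⇒∃[o]m+o≡n (ℕ.≮⇒≥ i≮n) =
    inj₂ (+ suc j , from ∈-interval (j , ℕ.+-cancelˡ-< n j p i<n+p , refl) ,
          cong (λ k → + suc k) (ℕ.+-comm n j))
  bwd : ∀ {c} → c ∈ interval n ⊎ ∃[ d ] (d ∈ interval p × c ≡ d +ℤ + n) → Window 1 (n + p) c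
  bwd (inj₁ c∈) with i , i<n , refl ← to ∈-interval c∈ = i , ℕ.<-≤-trans i<n (ℕ.m≤m+n n p) , refl
  bwd (inj₂ (d , d∈ , refl)) with j , j<p , refl ← to ∈-interval d∈ =
    j + n , subst (_< n + p) (ℕ.+-comm n j) (ℕ.+-monoʳ-< n j<p) , refl

IsSumset-swap : ∀ {C X Y} → IsSumset C X Y → IsSumset C Y X
IsSumset-swap C=X+Y c = mk⇔ (swap ∘ to (C=X+Y c)) (from (C=X+Y c) ∘ swap)
  where
  swap : ∀ {X Y} → InSumset X Y c → InSumset Y X c
  swap (a , b , a∈ , b∈ , refl) = b , a , b∈ , a∈ , ℤ.+-comm a b

IsSumset-++-shift : ∀ {C D X Y Z} t → IsSumset C X Y → IsSumset D X Z →
                    IsSumset (C ++ map (_+ℤ t) D) X (Y ++ map (_+ℤ t) Z)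
IsSumset-++-shift {C} {D} {X} {Y} {Z} t C=X+Y D=X+Z c = mk⇔ fwd bwd
  where
  fwd : c ∈ C ++ map (_+ℤ t) D → InSumset X (Y ++ map (_+ℤ t) Z) c
  fwd c∈ with to ∈-++-shift c∈
  ... | inj₁ c∈C with a , b , a∈ , b∈ , eq ← to (C=X+Y c) c∈C = a , b , a∈ , ∈-++⁺ˡ b∈ , eq
  ... | inj₂ (d , d∈D , refl) with a , b , a∈ , b∈ , refl ← to (D=X+Z d) d∈D =
    a , b +ℤ t , a∈ , from ∈-++-shift (inj₂ (b , b∈ , refl)) , ℤ.+-assoc a b t
  bwd : InSumset X (Y ++ map (_+ℤ t) Z) c → c ∈ C ++ map (_+ℤ t) D
  bwd (a , b , a∈ , b∈ , refl) with to ∈-++-shift b∈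
  ... | inj₁ b∈Y = ∈-++⁺ˡ (from (C=X+Y _) (a , b , a∈ , b∈Y , refl))
  ... | inj₂ (z , z∈Z , refl) =
    from ∈-++-shift (inj₂ (a +ℤ z , from (D=X+Z _) (a , z , a∈ , z∈Z , refl) , sym (ℤ.+-assoc a z t)))

Tiles-translates : ∀ m {n X Y} → Tiles n X Y → Tiles (m * n) X (translates m n Y)
Tiles-translates zero    _ _ = mk⇔ (λ ()) (λ { (_ , _ , _ , () , _) })
Tiles-translates (suc m) {n} X+Y=[n] c =
  IsSumset-++-shift (+ n) X+Y=[n] (Tiles-translates m X+Y=[n]) c ⇔-∘ ∈-interval-+ n (m * n)

Tiles-left-window : ∀ {n A B a} → Tiles n A B → + 0 ∈ B → a ∈ A → Window 1 n a
Tiles-left-window {a = a} A+B=[n] 0∈B a∈A =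
  to ∈-interval (from (A+B=[n] a) (a , + 0 , a∈A , 0∈B , sym (ℤ.+-identityʳ a)))

Tiles-right-window : ∀ {n A B a b} → Tiles n A B → + 0 ∈ B → All (+ 0 ≤ℤ_) B →
                     a ∈ A → b ∈ B → Window 0 n b
Tiles-right-window A+B=[n] 0∈B B≥0 a∈A b∈B with All.lookup B≥0 b∈B
... | ℤ.+≤+ {n = j} _
  with i , _ , refl ← Tiles-left-window A+B=[n] 0∈B a∈A
  with k , k<n , eq ← to ∈-interval (from (A+B=[n] _) (_ , _ , a∈A , b∈B , refl)) =
  j , ℕ.≤-<-trans (ℕ.≤-trans (ℕ.m≤n+m j i) (ℕ.≤-reflexive (ℕ.suc-injective (ℤ.+-injective eq)))) k<n , refl

length-translates : ∀ m t X → length (translates m t X) ≡ m * length X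
length-translates zero    t X = refl
length-translates (suc m) t X = begin
  length (X ++ map (_+ℤ + t) (translates m t X))  ≡⟨ length-++ X ⟩
  length X + length (map (_+ℤ + t) (translates m t X)) ≡⟨ cong (_+_ (length X)) (length-map _ (translates m t X)) ⟩
  length X + length (translates m t X)            ≡⟨ cong (_+_ (length X)) (length-translates m t X) ⟩
  length X + m * length X                         ∎
  where open ≡-Reasoning

∈-translates⁻ : ∀ m {t X z} → z ∈ translates m t X → ∃[ j ] ∃[ x ] (j < m × x ∈ X × z ≡ x +ℤ + (j * t))
∈-translates⁻ (suc m) {t} {X} z∈ with to ∈-++-shift z∈
... | inj₁ z∈X = 0 , _ , z<s , z∈X , sym (ℤ.+-identityʳ _)
... | inj₂ (y , y∈ , refl) with j , x , j<m , x∈X , refl ← ∈-translates⁻ m y∈ =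
  suc j , x , s<s j<m , x∈X , (begin
    x +ℤ + (j * t) +ℤ + t   ≡⟨ ℤ.+-assoc x (+ (j * t)) (+ t) ⟩
    x +ℤ + (j * t + t)      ≡⟨ cong (λ k → x +ℤ + k) (ℕ.+-comm (j * t) t) ⟩
    x +ℤ + (suc j * t)      ∎)
  where open ≡-Reasoning

∈-translates-second : ∀ m {t X x} → x ∈ X → x +ℤ + t ∈ translates (suc (suc m)) t X
∈-translates-second m {X = X} x∈X = ∈-++⁺ʳ X (∈-map⁺ _ (∈-++⁺ˡ x∈X))

translates-window : ∀ m {o w t X z} → (∀ {x} → x ∈ X → Window o w x) → w ≤ t →
                    z ∈ translates m t X → Window o (m * t) z
translates-window m {o} {w} {t} X⊆window w≤t z∈
  with j , x , j<m , x∈X , refl ← ∈-translates⁻ m z∈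
  with i , i<w , refl ← X⊆window x∈X =
  i + j * t , i+jt<mt , cong +_ (ℕ.+-assoc o i (j * t))
  where
  open ℕ.≤-Reasoning
  i+jt<mt : i + j * t < m * t
  i+jt<mt = begin-strict
    i + j * t  <⟨ ℕ.+-monoˡ-< (j * t) (ℕ.<-≤-trans i<w w≤t) ⟩
    suc j * t  ≤⟨ ℕ.*-monoˡ-≤ t j<m ⟩
    m * t      ∎

translates-sorted : ∀ m {t X} → AllPairs _<ℤ_ X → WidthBelow t X → AllPairs _<ℤ_ (translates m t X)
translates-sorted zero    _      _     = AllPairs.[]
translates-sorted (suc m) {t} {X} X-sorted X-narrow =
  AllPairs.++⁺ X-sorted
    (AllPairs.map⁺ (AllPairs.map (ℤ.+-monoˡ-< (+ t)) (translates-sorted m X-sorted X-narrow)))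
    (All.tabulate λ x∈X → All.tabulate λ z∈ → below x∈X (∈-map⁻ _ z∈))
  where
  below : ∀ {x z} → x ∈ X → ∃[ y ] (y ∈ translates m t X × z ≡ y +ℤ + t) → x <ℤ z
  below x∈X (y , y∈ , refl) with j , x′ , _ , x′∈X , refl ← ∈-translates⁻ m y∈ =
    ℤ.<-≤-trans (X-narrow x∈X x′∈X) (ℤ.+-monoˡ-≤ (+ t) (ℤ.i≤i+j x′ (+ (j * t))))

translates-increasing : ∀ m {t X} → Linked _<ℤ_ X → WidthBelow t X → Linked _<ℤ_ (translates m t X)
translates-increasing m X-increasing X-narrow =
  AllPairs⇒Linked (translates-sorted m (Linked⇒AllPairs ℤ.<-trans X-increasing) X-narrow)

translates-nonnegative : ∀ m {t X} → All (+ 0 ≤ℤ_) X → All (+ 0 ≤ℤ_) (translates m t X)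
translates-nonnegative m {t} X≥0 = All.tabulate λ z∈ → nonnegative (∈-translates⁻ m z∈)
  where
  nonnegative : ∀ {z} → ∃[ j ] ∃[ x ] (j < m × x ∈ _ × z ≡ x +ℤ + (j * t)) → + 0 ≤ℤ z
  nonnegative (j , x , _ , x∈X , refl) = ℤ.≤-trans (All.lookup X≥0 x∈X) (ℤ.i≤i+j x (+ (j * t)))

++-injectiveˡ : ∀ {xs ys as bs : List ℤ} → length xs ≡ length ys → xs ++ as ≡ ys ++ bs → xs ≡ ys
++-injectiveˡ {[]}     {[]}     _     _  = refl
++-injectiveˡ {x ∷ xs} {y ∷ ys} |xs|≡|ys| eq with refl , eq′ ← ∷-injective eq =
  cong (x ∷_) (++-injectiveˡ (ℕ.suc-injective |xs|≡|ys|) eq′)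

translates-injective : ∀ m t {X Y} → translates (suc m) t X ≡ translates (suc m) t Y → X ≡ Y
translates-injective m t {X} {Y} eq = ++-injectiveˡ |X|≡|Y| eq
  where
  |X|≡|Y| : length X ≡ length Y
  |X|≡|Y| = ℕ.*-cancelˡ-≡ (length X) (length Y) (suc m)
    (trans (sym (length-translates (suc m) t X)) (trans (cong length eq) (length-translates (suc m) t Y)))

Window-width : ∀ {o n t X} → (∀ {x} → x ∈ X → Window o n x) → n ≤ t → WidthBelow t X
Window-width {o} {n} {t} X⊆window n≤t x∈X y∈X
  with j , j<n , refl ← X⊆window x∈X | j′ , _ , refl ← X⊆window y∈X =
  ℤ.+<+ (subst (o + j <_) (sym (ℕ.+-assoc o j′ t)) (ℕ.+-monoʳ-< o (ℕ.<-≤-trans j<n (ℕ.≤-trans n≤t (ℕ.m≤n+m t j′)))))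

Window-outside : ∀ {o n k x} → n ≤ k → Window o n x → x ≡ + (o + k) → ⊥
Window-outside {o} n≤k (j , j<n , refl) eq =
  ℕ.<-irrefl (ℕ.+-cancelˡ-≡ o j _ (ℤ.+-injective eq)) (ℕ.<-≤-trans j<n n≤k)

nonempty : ∀ {A : List ℤ} {d α} → 1 ≤ α → length A * d ≡ α → ∃[ a ] a ∈ A
nonempty {[]}    (s≤s _) ()
nonempty {a ∷ _} _       _  = a , here refl

𝒯-≡ : ∀ {α d C} {x y : 𝒯 α d C} → 𝒯.A x ≡ 𝒯.A y → 𝒯.B x ≡ 𝒯.B y → x ≡ y
𝒯-≡ {x = mk𝒯 _ _ _ _ _ _ _ _ _} {y = mk𝒯 _ _ _ _ _ _ _ _ _} refl refl = refl

length-interval-* : ∀ m {n N k} → m * n ≡ N → length (interval n) ≡ k → length (interval N) ≡ m * k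
length-interval-* m {n} {N} {k} mn≡N |[n]|≡k = begin
  length (interval N)  ≡⟨ length-interval N ⟩
  N                    ≡⟨ sym mn≡N ⟩
  m * n                ≡⟨ cong (m *_) (trans (sym (length-interval n)) |[n]|≡k) ⟩
  m * k                ∎
  where open ≡-Reasoning

extendRight : ∀ m {α d n N} → 1 ≤ α → suc m * n ≡ N → 𝒯 α d (interval n) → 𝒯 α d (interval N)
extendRight m {n = n} 1≤α eq (mk𝒯 A B A-inc B-inc A+B=[n] card sizeA 0∈B B≥0) = mk𝒯
  A (translates (suc m) n B)
  A-inc
  (translates-increasing (suc m) B-inc
    (Window-width (Tiles-right-window A+B=[n] 0∈B B≥0 (proj₂ (nonempty 1≤α sizeA))) ℕ.≤-refl))
  (subst (λ k → Tiles k A _) eq (Tiles-translates (suc m) A+B=[n]))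
  (trans (length-interval-* (suc m) eq card)
         (trans (x∙yz≈y∙xz (suc m) (length A) (length B)) (cong (length A *_) (sym (length-translates (suc m) n B)))))
  sizeA
  (∈-++⁺ˡ 0∈B)
  (translates-nonnegative (suc m) B≥0)

extendLeft : ∀ m {α d n N} → suc m * n ≡ N → 𝒯 α (suc m * d) (interval n) → 𝒯 α d (interval N)
extendLeft m {d = d} {n = n} eq (mk𝒯 A B A-inc B-inc A+B=[n] card sizeA 0∈B B≥0) = mk𝒯
  (translates (suc m) n A) B
  (translates-increasing (suc m) A-inc (Window-width (Tiles-left-window A+B=[n] 0∈B) ℕ.≤-refl))
  B-inc
  (subst (λ k → Tiles k _ B) eq (IsSumset-swap (Tiles-translates (suc m) (IsSumset-swap A+B=[n]))))
  (trans (length-interval-* (suc m) eq card)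
         (trans (sym (ℕ.*-assoc (suc m) (length A) (length B)))
                (cong (_* length B) (sym (length-translates (suc m) n A)))))
  (trans (cong (_* d) (length-translates (suc m) n A)) (trans (xy∙z≈y∙xz (suc m) (length A) d) sizeA))
  0∈B
  B≥0

extendRight-injective : ∀ m {α d n N} (1≤α : 1 ≤ α) (eq : suc m * n ≡ N) →
                           Injective _≡_ _≡_ (extendRight m {α} {d} 1≤α eq)
extendRight-injective m {n = n} 1≤α eq {mk𝒯 _ _ _ _ _ _ _ _ _} {mk𝒯 _ _ _ _ _ _ _ _ _} x′≡y′ =
  𝒯-≡ (cong 𝒯.A x′≡y′) (translates-injective m n (cong 𝒯.B x′≡y′))

extendLeft-injective : ∀ m {α d n N} (eq : suc m * n ≡ N) →
                          Injective _≡_ _≡_ (extendLeft m {α} {d} eq)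
extendLeft-injective m {n = n} eq {mk𝒯 _ _ _ _ _ _ _ _ _} {mk𝒯 _ _ _ _ _ _ _ _ _} x′≡y′ =
  𝒯-≡ (translates-injective m n (cong 𝒯.A x′≡y′)) (cong 𝒯.B x′≡y′)

[,]-injective : ∀ {X Y Z : Set} {f : X → Z} {g : Y → Z} → Injective _≡_ _≡_ f → Injective _≡_ _≡_ g →
                (∀ x y → f x ≢ g y) → Injective _≡_ _≡_ [ f , g ]
[,]-injective f-inj g-inj f≢g {inj₁ x} {inj₁ y} eq = cong inj₁ (f-inj eq)
[,]-injective f-inj g-inj f≢g {inj₁ x} {inj₂ y} eq = ⊥-elim (f≢g x y eq)
[,]-injective f-inj g-inj f≢g {inj₂ x} {inj₁ y} eq = ⊥-elim (f≢g y x (sym eq))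
[,]-injective f-inj g-inj f≢g {inj₂ x} {inj₂ y} eq = cong inj₂ (g-inj eq)

HasCard-⊎ : ∀ {X Y a b} → HasCard X a → HasCard Y b → HasCard (X ⊎ Y) (a + b)
HasCard-⊎ X↔a Y↔b = ↔-sym +↔⊎ ↔-∘ (X↔a ⊎-↔ Y↔b)

HasCard-≤ : ∀ {X Y a b} → HasCard X a → HasCard Y b → X ↣ Y → a ≤ b
HasCard-≤ X↔a Y↔b X↣Y = injective⇒≤ (Injection.injective (↔⇒↣ Y↔b ↣-∘ (X↣Y ↣-∘ ↔⇒↣ (↔-sym X↔a))))

b+j*6u≢9u : ∀ u {b j} → 1 ≤ u → b < 2 * u → b + j * (3 * (2 * u)) ≢ u * 9
b+j*6u≢9u u {b} {j} 1≤u b<2u eq with j ≤? 1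
... | yes j≤1 = ℕ.<-irrefl eq (begin-strict
  b + j * (3 * (2 * u))          <⟨ ℕ.+-mono-<-≤ b<2u (ℕ.*-monoˡ-≤ (3 * (2 * u)) j≤1) ⟩
  2 * u + 1 * (3 * (2 * u))      ≤⟨ ℕ.m≤m+n _ u ⟩
  2 * u + 1 * (3 * (2 * u)) + u  ≡⟨ 8u+u≡9u u ⟩
  u * 9                          ∎)
  where
  open ℕ.≤-Reasoning
  8u+u≡9u : ∀ u → 2 * u + 1 * (3 * (2 * u)) + u ≡ u * 9
  8u+u≡9u = solve-∀
... | no  j≰1 = ℕ.<-irrefl (sym eq) (begin-strict
  u * 9                  <⟨ ℕ.m<m+n (u * 9) (ℕ.≤-trans 1≤u (ℕ.m≤n*m u 3)) ⟩
  u * 9 + 3 * u          ≡⟨ 9u+3u≡12u u ⟩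
  2 * (3 * (2 * u))      ≤⟨ ℕ.*-monoˡ-≤ (3 * (2 * u)) (ℕ.≰⇒> j≰1) ⟩
  j * (3 * (2 * u))      ≤⟨ ℕ.m≤n+m _ b ⟩
  b + j * (3 * (2 * u))  ∎)
  where
  open ℕ.≤-Reasoning
  9u+3u≡12u : ∀ u → u * 9 + 3 * u ≡ 2 * (3 * (2 * u))
  9u+3u≡12u = solve-∀

3*3*2u≡2u*9 : ∀ u → 3 * (3 * (2 * u)) ≡ 2 * u * 9
3*3*2u≡2u*9 = solve-∀

6u≤9u : ∀ u → 3 * (2 * u) ≤ u * 9
6u≤9u u = subst (3 * (2 * u) ≤_) (6u+3u≡9u u) (ℕ.m≤m+n (3 * (2 * u)) (3 * u))
  where
  6u+3u≡9u : ∀ u → 3 * (2 * u) + 3 * u ≡ u * 9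
  6u+3u≡9u = solve-∀

9u∉translates-6u : ∀ {u B} → 1 ≤ u → (∀ {b} → b ∈ B → Window 0 (2 * u) b) →
                   + (u * 9) ∉ translates 3 (3 * (2 * u)) B
9u∉translates-6u {u} 1≤u B⊆window 9u∈ with j , _ , _ , b∈B , eq ← ∈-translates⁻ 3 9u∈
  with b , b<2u , refl ← B⊆window b∈B = b+j*6u≢9u u {j = j} 1≤u b<2u (sym (ℤ.+-injective eq))

translates-9u≢translates-2u : ∀ u {A₂ A₃ a} → (∀ {a} → a ∈ A₂ → Window 1 (u * 9) a) → a ∈ A₂ →
                              (∀ {a} → a ∈ A₃ → Window 1 (2 * u) a) →
                              translates 2 (u * 9) A₂ ≢ translates 3 (2 * u) A₃
translates-9u≢translates-2u u {A₃ = A₃} A₂⊆window a∈A₂ A₃⊆window eq with i , _ , refl ← A₂⊆window a∈A₂ =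
  Window-outside (ℕ.≤-trans (6u≤9u u) (ℕ.m≤n+m (u * 9) i)) (translates-window 3 A₃⊆window ℕ.≤-refl a+9u∈) refl
  where
  a+9u∈ : + (suc i + u * 9) ∈ translates 3 (2 * u) A₃
  a+9u∈ = subst (+ (suc i + u * 9) ∈_) eq (∈-translates-second 0 a∈A₂)

module _ {α u : ℕ} (1≤α : 1 ≤ α) (1≤u : 1 ≤ u) where

  doubleRight : 𝒯 α 1 (interval (u * 9)) → 𝒯 α 1 (interval (2 * u * 9))
  doubleRight = extendRight 1 1≤α (sym (ℕ.*-assoc 2 u 9))

  doubleRight-injective : Injective _≡_ _≡_ doubleRight
  doubleRight-injective = extendRight-injective 1 1≤α (sym (ℕ.*-assoc 2 u 9))

  doubleLeft : 𝒯 α 2 (interval (u * 9)) → 𝒯 α 1 (interval (2 * u * 9))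
  doubleLeft = extendLeft 1 (sym (ℕ.*-assoc 2 u 9))

  doubleLeft-injective : Injective _≡_ _≡_ doubleLeft
  doubleLeft-injective = extendLeft-injective 1 (sym (ℕ.*-assoc 2 u 9))

  tripleBoth : 𝒯 α 3 (interval (2 * u)) → 𝒯 α 1 (interval (2 * u * 9))
  tripleBoth = extendRight 2 1≤α (3*3*2u≡2u*9 u) ∘ extendLeft 2 refl

  tripleBoth-injective : Injective _≡_ _≡_ tripleBoth
  tripleBoth-injective = extendLeft-injective 2 refl ∘ extendRight-injective 2 1≤α (3*3*2u≡2u*9 u)

  -- The fields of 𝒯 are irrelevant, so what they yield can only be used to prove ⊥ irrelevantly.
  doubleRight≢doubleLeft : ∀ x y → doubleRight x ≢ doubleLeft y
  doubleRight≢doubleLeft (mk𝒯 _ _ _ _ _ _ _ 0∈B₁ _) (mk𝒯 _ _ _ _ A₂+B₂ _ sizeA₂ 0∈B₂ B₂≥0) eq =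
    ⊥-elim-irr (Window-outside ℕ.≤-refl
      (Tiles-right-window A₂+B₂ 0∈B₂ B₂≥0 (proj₂ (nonempty 1≤α sizeA₂))
        (subst (+ (u * 9) ∈_) (cong 𝒯.B eq) (∈-translates-second 0 0∈B₁)))
      refl)

  doubleRight≢tripleBoth : ∀ x y → doubleRight x ≢ tripleBoth y
  doubleRight≢tripleBoth (mk𝒯 _ _ _ _ _ _ _ 0∈B₁ _) (mk𝒯 _ _ _ _ A₃+B₃ _ sizeA₃ 0∈B₃ B₃≥0) eq =
    ⊥-elim-irr (9u∉translates-6u 1≤u (Tiles-right-window A₃+B₃ 0∈B₃ B₃≥0 (proj₂ (nonempty 1≤α sizeA₃)))
      (subst (+ (u * 9) ∈_) (cong 𝒯.B eq) (∈-translates-second 0 0∈B₁)))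

  doubleLeft≢tripleBoth : ∀ x y → doubleLeft x ≢ tripleBoth y
  doubleLeft≢tripleBoth (mk𝒯 _ _ _ _ A₂+B₂ _ sizeA₂ 0∈B₂ _) (mk𝒯 _ _ _ _ A₃+B₃ _ _ 0∈B₃ _) eq =
    ⊥-elim-irr (translates-9u≢translates-2u u (Tiles-left-window A₂+B₂ 0∈B₂) (proj₂ (nonempty 1≤α sizeA₂))
      (Tiles-left-window A₃+B₃ 0∈B₃) (cong 𝒯.A eq))

  embed : ((𝒯 α 1 (interval (u * 9)) ⊎ 𝒯 α 2 (interval (u * 9))) ⊎ 𝒯 α 3 (interval (2 * u))) ↣
          𝒯 α 1 (interval (2 * u * 9))
  embed = mk↣ ([,]-injective
    ([,]-injective doubleRight-injective doubleLeft-injective doubleRight≢doubleLeft)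
    tripleBoth-injective
    [ doubleRight≢tripleBoth , doubleLeft≢tripleBoth ])

lemma10 : (k α : ℕ) → 1 ≤ k → 1 ≤ α → 3 ∣ α → ¬ (9 ∣ α) →
    (m₀ m₁ m₂ m₃ : ℕ) →
    HasCard (𝒯 α 1 (interval (2 ^ k * 9))) m₀ →
    HasCard (𝒯 α 1 (interval (2 ^ (k ∸ 1) * 9))) m₁ →
    HasCard (𝒯 α 2 (interval (2 ^ (k ∸ 1) * 9))) m₂ →
    HasCard (𝒯 α 3 (interval (2 ^ k))) m₃ →
    m₁ + m₂ + m₃ ≤ m₀
lemma10 (suc k) α _ 1≤α _ _ m₀ m₁ m₂ m₃ card₀ card₁ card₂ card₃ =
  HasCard-≤ (HasCard-⊎ (HasCard-⊎ card₁ card₂) card₃) card₀ (embed 1≤α (ℕ.m^n>0 2 k))
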